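{- Let $G=(V,E)$ be a finite graph with orientation $\varepsilon$, $A,B$ abelian groups, $\Omega=T(G,\varepsilon;A)\times F(G,\varepsilon;B)$, $R$ a commutative ring, $u\in R$, and $\nu$ an $R$-valued valuation on the Boolean algebra of subsets of $\Omega$ generated by products of a coset of a subgroup of $T(G,\varepsilon;A)$ with a coset of a subgroup of $F(G,\varepsilon;B)$. Then \[ \iint\limits_{\operatorname{supp}g\subseteq\ker f}u^{|\operatorname{supp}g|}(u+1)^{|\ker f-\operatorname{supp}g|}\,d\nu(f,g)=\sum_{X\subseteq E}u^{|X|}\,\nu(\Omega_{X,E-X}). \]
   Context: $T(G,\varepsilon;A)$ and $F(G,\varepsilon;B)$ are the groups of $A$-valued tensions (zero signed sum around every circuit traversal) and $B$-valued flows (net flow zero at every vertex). $\operatorname{supp}f=\{e:f(e)\ne0\}$, $\ker f=E-\operatorname{supp}f$. $\Omega_{X,Y}=\{(f,g)\in\Omega:f|_X=0,\ g|_Y=0\}$, $\Omega^0_{X,Y}=\{(f,g)\in\Omega:\ker f=X,\ \ker g=Y\}$. A valuation satisfies $\nu(\emptyset)=0$, $\nu(S\cup S')+\nu(S\cap S')=\nu(S)+\nu(S')$. For a condition $P$ on $(\ker f,\ker g)$ and weight depending only on $(\ker f,\ker g)=(X,Y)$, $\iint_Pw\,d\nu:=\sum_{(X,Y)\text{ satisfying }P}w_{X,Y}\nu(\Omega^0_{X,Y})$; convention $0^0=1$. -}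

module Defs where

open import Level using (Level; _⊔_; 0ℓ; Lift; lift; lower) renaming (suc to lsuc)
open import Algebra.Bundles using (AbelianGroup; CommutativeRing)
import Algebra.Properties.AbelianGroup as AGProps
import Algebra.Properties.Semiring.Exp as Exp
open import Data.Bool.Base using (Bool; true; false; if_then_else_)
open import Data.Nat.Base using (ℕ; zero; suc; _<_)
open import Data.Fin.Base using (Fin; zero; suc)
open import Data.Fin.Properties using (_≟_)
open import Data.Fin.Subset using (Subset; inside; outside; _∈_; _⊆_; ∁; ⊥; ⁅_⁆)
open import Data.Fin.Subset.Properties using (_⊆?_)
open import Data.Vec.Base using (Vec; []; _∷_; lookup)
open import Data.List.Base using (List; []; _∷_; _++_; map; foldr; length; concatMap; filter)
open import Data.List.Relation.Unary.Unique.Propositional using (Unique)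
open import Data.Product.Base using (Σ; _×_; _,_; proj₁; proj₂)
open import Data.Sum.Base using (_⊎_)
open import Function.Bundles using (_⇔_)
open import Relation.Nullary using (¬_; Dec; yes; no; does)
open import Relation.Binary.PropositionalEquality using (_≡_)

-- Vertices are Fin n, edges are Fin m; the orientation ε directs each
-- edge e from its tail to its head.  Loops (tail e = head e) and parallel
-- edges are allowed.

record OrientedGraph : Set where
  field
    n    : ℕ
    m    : ℕ
    tail : Fin m → Fin n
    head : Fin m → Fin n

module GroupFacts {c ℓ} (C : AbelianGroup c ℓ) where
  open AbelianGroup C
  open AGProps C using (⁻¹-∙-comm; ε⁻¹≈ε)
  open import Algebra.Properties.CommutativeSemigroup commutativeSemigroup using (interchange)

  record IsSubgroupPred {k p} (P : (Fin k → Carrier) → Set p) : Set (c ⊔ ℓ ⊔ p) where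
    field
      resp : ∀ {x y} → (∀ e → x e ≈ y e) → P x → P y
      has-ε : P (λ _ → ε)
      has-∙ : ∀ {x y} → P x → P y → P (λ e → x e ∙ y e)
      has-⁻¹ : ∀ {x} → P x → P (λ e → x e ⁻¹)

  record Linear {k} (L : (Fin k → Carrier) → Carrier) : Set (c ⊔ ℓ) where
    field
      resp : ∀ {x y} → (∀ e → x e ≈ y e) → L x ≈ L y
      lin-∙ : ∀ x y → L (λ e → x e ∙ y e) ≈ L x ∙ L y
      lin-⁻¹ : ∀ x → L (λ e → x e ⁻¹) ≈ (L x) ⁻¹
      lin-ε : L (λ _ → ε) ≈ ε

  record Hom (h : Carrier → Carrier) : Set (c ⊔ ℓ) where
    field
      resp : ∀ {a b} → a ≈ b → h a ≈ h b
      hom-∙ : ∀ a b → h (a ∙ b) ≈ h a ∙ h b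
      hom-⁻¹ : ∀ a → h (a ⁻¹) ≈ (h a) ⁻¹
      hom-ε : h ε ≈ ε

  const-ε-linear : ∀ {k} → Linear {k} (λ _ → ε)
  const-ε-linear = record
    { resp = λ _ → refl ; lin-∙ = λ _ _ → sym (identityˡ ε)
    ; lin-⁻¹ = λ _ → sym ε⁻¹≈ε ; lin-ε = refl }

  prod-linear : ∀ {k} {L₁ L₂ : (Fin k → Carrier) → Carrier} → Linear L₁ → Linear L₂ →
    Linear (λ x → L₁ x ∙ L₂ x)
  prod-linear {L₁ = L₁} {L₂} H₁ H₂ = record
    { resp = λ p → ∙-cong (Linear.resp H₁ p) (Linear.resp H₂ p)
    ; lin-∙ = λ x y → trans (∙-cong (Linear.lin-∙ H₁ x y) (Linear.lin-∙ H₂ x y))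
                        (interchange (L₁ x) (L₁ y) (L₂ x) (L₂ y))
    ; lin-⁻¹ = λ x → trans (∙-cong (Linear.lin-⁻¹ H₁ x) (Linear.lin-⁻¹ H₂ x))
                        (⁻¹-∙-comm (L₁ x) (L₂ x))
    ; lin-ε = trans (∙-cong (Linear.lin-ε H₁) (Linear.lin-ε H₂)) (identityˡ ε)
    }

  hom-eval-linear : ∀ {k} {h} (e : Fin k) → Hom h → Linear (λ x → h (x e))
  hom-eval-linear e H = record
    { resp = λ p → Hom.resp H (p e) ; lin-∙ = λ x y → Hom.hom-∙ H (x e) (y e)
    ; lin-⁻¹ = λ x → Hom.hom-⁻¹ H (x e) ; lin-ε = Hom.hom-ε H }

  kernel-subgroup : ∀ {k i} {I : Set i} (L : I → (Fin k → Carrier) → Carrier) →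
    (∀ j → Linear (L j)) → IsSubgroupPred (λ x → ∀ j → L j x ≈ ε)
  kernel-subgroup L lin = record
    { resp = λ x≈y Px j → trans (sym (Linear.resp (lin j) x≈y)) (Px j)
    ; has-ε = λ j → Linear.lin-ε (lin j)
    ; has-∙ = λ {x} {y} Px Py j → trans (Linear.lin-∙ (lin j) x y)
                 (trans (∙-cong (Px j) (Py j)) (identityˡ ε))
    ; has-⁻¹ = λ {x} Px j → trans (Linear.lin-⁻¹ (lin j) x)
                 (trans (⁻¹-cong (Px j)) ε⁻¹≈ε)
    }

  ∩-subgroup : ∀ {k p q} {P : (Fin k → Carrier) → Set p} {Q : (Fin k → Carrier) → Set q} →
    IsSubgroupPred P → IsSubgroupPred Q → IsSubgroupPred (λ x → P x × Q x)
  ∩-subgroup sP sQ = record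
    { resp = λ x≈y (a , b) → IsSubgroupPred.resp sP x≈y a , IsSubgroupPred.resp sQ x≈y b
    ; has-ε = IsSubgroupPred.has-ε sP , IsSubgroupPred.has-ε sQ
    ; has-∙ = λ (a , b) (a′ , b′) → IsSubgroupPred.has-∙ sP a a′ , IsSubgroupPred.has-∙ sQ b b′
    ; has-⁻¹ = λ (a , b) → IsSubgroupPred.has-⁻¹ sP a , IsSubgroupPred.has-⁻¹ sQ b
    }

  lift-subgroup : ∀ {k p} q {P : (Fin k → Carrier) → Set p} → IsSubgroupPred P →
    IsSubgroupPred (λ x → Lift q (P x))
  lift-subgroup q sP = record
    { resp = λ x≈y Px → lift (IsSubgroupPred.resp sP x≈y (lower Px))
    ; has-ε = lift (IsSubgroupPred.has-ε sP)
    ; has-∙ = λ Px Py → lift (IsSubgroupPred.has-∙ sP (lower Px) (lower Py))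
    ; has-⁻¹ = λ Px → lift (IsSubgroupPred.has-⁻¹ sP (lower Px))
    }

  vanish-subgroup : ∀ {k} (X : Fin k → Set) → IsSubgroupPred (λ x → ∀ e → X e → x e ≈ ε)
  vanish-subgroup X = record
    { resp = λ x≈y Px e Xe → trans (sym (x≈y e)) (Px e Xe)
    ; has-ε = λ _ _ → refl
    ; has-∙ = λ Px Py e Xe → trans (∙-cong (Px e Xe) (Py e Xe)) (identityˡ ε)
    ; has-⁻¹ = λ Px e Xe → trans (⁻¹-cong (Px e Xe)) ε⁻¹≈ε
    }

  eval-linear : ∀ {k} (e : Fin k) → Linear (λ x → x e)
  eval-linear e = record
    { resp = λ x≈y → x≈y e ; lin-∙ = λ _ _ → refl ; lin-⁻¹ = λ _ → refl ; lin-ε = refl }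

  id-hom : Hom (λ a → a)
  id-hom = record { resp = λ p → p ; hom-∙ = λ _ _ → refl ; hom-⁻¹ = λ _ → refl ; hom-ε = refl }

  inv-hom : Hom _⁻¹
  inv-hom = record
    { resp = ⁻¹-cong ; hom-∙ = λ a b → sym (⁻¹-∙-comm a b)
    ; hom-⁻¹ = λ _ → refl ; hom-ε = ε⁻¹≈ε }

  sel : Bool → Carrier → Carrier
  sel true a = a
  sel false a = ε

  sel-hom : ∀ b {h} → Hom h → Hom (λ a → sel b (h a))
  sel-hom true hh = hh
  sel-hom false hh = record
    { resp = λ _ → refl ; hom-∙ = λ _ _ → sym (identityˡ ε)
    ; hom-⁻¹ = λ _ → sym ε⁻¹≈ε ; hom-ε = refl }

  prod-hom : ∀ {h₁ h₂} → Hom h₁ → Hom h₂ → Hom (λ a → h₁ a ∙ h₂ a)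
  prod-hom {h₁} {h₂} H₁ H₂ = record
    { resp = λ p → ∙-cong (Hom.resp H₁ p) (Hom.resp H₂ p)
    ; hom-∙ = λ a b → trans (∙-cong (Hom.hom-∙ H₁ a b) (Hom.hom-∙ H₂ a b))
                        (interchange (h₁ a) (h₁ b) (h₂ a) (h₂ b))
    ; hom-⁻¹ = λ a → trans (∙-cong (Hom.hom-⁻¹ H₁ a) (Hom.hom-⁻¹ H₂ a))
                        (⁻¹-∙-comm (h₁ a) (h₂ a))
    ; hom-ε = trans (∙-cong (Hom.hom-ε H₁) (Hom.hom-ε H₂)) (identityˡ ε)
    }

  sumFin : ∀ {k} → (Fin k → Carrier) → Carrier
  sumFin {zero} x = ε
  sumFin {suc k} x = x zero ∙ sumFin (λ e → x (suc e))

  sumFin-linear : ∀ {k} (h : Fin k → Carrier → Carrier) → (∀ e → Hom (h e)) →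
    Linear (λ x → sumFin (λ e → h e (x e)))
  sumFin-linear {zero} h H = record
    { resp = λ _ → refl ; lin-∙ = λ _ _ → sym (identityˡ ε)
    ; lin-⁻¹ = λ _ → sym ε⁻¹≈ε ; lin-ε = refl }
  sumFin-linear {suc k} h H = record
    { resp = λ p → ∙-cong (Hom.resp (H zero) (p zero)) (Linear.resp IH (λ e → p (suc e)))
    ; lin-∙ = λ x y → trans (∙-cong (Hom.hom-∙ (H zero) (x zero) (y zero))
                                    (Linear.lin-∙ IH (λ e → x (suc e)) (λ e → y (suc e))))
                       (interchange _ _ _ _)
    ; lin-⁻¹ = λ x → trans (∙-cong (Hom.hom-⁻¹ (H zero) (x zero))
                                   (Linear.lin-⁻¹ IH (λ e → x (suc e))))
                       (⁻¹-∙-comm _ _)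
    ; lin-ε = trans (∙-cong (Hom.hom-ε (H zero)) (Linear.lin-ε IH)) (identityˡ ε)
    }
    where IH = sumFin-linear (λ e → h (suc e)) (λ e → H (suc e))

module Walks (G : OrientedGraph) where
  open OrientedGraph G

  -- a step traverses an edge forwards (true: tail → head)
  -- or backwards (false: head → tail)
  Step : Set
  Step = Fin m × Bool

  src tgt : Step → Fin n
  src (e , true) = tail e
  src (e , false) = head e
  tgt (e , true) = head e
  tgt (e , false) = tail e

  data Walk (u w : Fin n) : Set where
    done : u ≡ w → Walk u w
    step : (s : Step) → src s ≡ u → Walk (tgt s) w → Walk u w

  edgesOf : ∀ {u w} → Walk u w → List (Fin m)
  edgesOf (done _) = []
  edgesOf (step s _ c) = proj₁ s ∷ edgesOf c

  startsOf : ∀ {u w} → Walk u w → List (Fin n)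
  startsOf (done _) = []
  startsOf (step s _ c) = src s ∷ startsOf c

  IsCircuit : ∀ {v} → Walk v v → Set
  IsCircuit c = (0 < length (edgesOf c)) × Unique (edgesOf c) × Unique (startsOf c)

module Setting {a ℓa b ℓb} (G : OrientedGraph) (A : AbelianGroup a ℓa) (B : AbelianGroup b ℓb) where
  open OrientedGraph G
  open Walks G
  private
    module A = AbelianGroup A
    module B = AbelianGroup B
    module GA = GroupFacts A
    module GB = GroupFacts B

  stepHom : Bool → A.Carrier → A.Carrier
  stepHom true a = a
  stepHom false a = a A.⁻¹

  stepHom-hom : ∀ d → GA.Hom (stepHom d)
  stepHom-hom true = GA.id-hom
  stepHom-hom false = GA.inv-hom

  walkSum : (Fin m → A.Carrier) → ∀ {u w} → Walk u w → A.Carrier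
  walkSum x (done _) = A.ε
  walkSum x (step (e , d) _ c) = stepHom d (x e) A.∙ walkSum x c

  walkSum-linear : ∀ {u w} (c : Walk u w) → GA.Linear (λ x → walkSum x c)
  walkSum-linear (done _) = GA.const-ε-linear
  walkSum-linear (step (e , d) _ c) =
    GA.prod-linear (GA.hom-eval-linear e (stepHom-hom d)) (walkSum-linear c)

  CircuitTraversal : Set
  CircuitTraversal = Σ (Fin n) λ v → Σ (Walk v v) IsCircuit

  IsTension : (Fin m → A.Carrier) → Set ℓa
  IsTension x = ∀ (C : CircuitTraversal) → walkSum x (proj₁ (proj₂ C)) A.≈ A.ε

  tension-subgroup : GA.IsSubgroupPred IsTension
  tension-subgroup = GA.kernel-subgroup (λ C x → walkSum x (proj₁ (proj₂ C)))
                       (λ C → walkSum-linear (proj₁ (proj₂ C)))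

  -- net flow of y : E → B into v: Σ_{head e = v} y(e) − Σ_{tail e = v} y(e)
  flowTerm : Fin n → Fin m → B.Carrier → B.Carrier
  flowTerm v e a = GB.sel (does (head e ≟ v)) a B.∙ GB.sel (does (tail e ≟ v)) (a B.⁻¹)

  netFlow : (Fin m → B.Carrier) → Fin n → B.Carrier
  netFlow y v = GB.sumFin (λ e → flowTerm v e (y e))

  IsFlow : (Fin m → B.Carrier) → Set ℓb
  IsFlow y = ∀ v → netFlow y v B.≈ B.ε

  flow-subgroup : GB.IsSubgroupPred IsFlow
  flow-subgroup = GB.kernel-subgroup (λ v y → netFlow y v)
    (λ v → GB.sumFin-linear (flowTerm v)
       (λ e → GB.prod-hom (GB.sel-hom (does (head e ≟ v)) GB.id-hom)
                          (GB.sel-hom (does (tail e ≟ v)) GB.inv-hom)))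

  record Ω : Set (a ⊔ b ⊔ ℓa ⊔ ℓb) where
    field
      f : Fin m → A.Carrier
      f-tension : IsTension f
      g : Fin m → B.Carrier
      g-flow : IsFlow g
  open Ω public

  record SubgroupT : Set (lsuc (a ⊔ ℓa)) where
    field
      P : (Fin m → A.Carrier) → Set (a ⊔ ℓa)
      isSubgroup : GA.IsSubgroupPred P
      ⊆T : ∀ {x} → P x → IsTension x

  record SubgroupF : Set (lsuc (b ⊔ ℓb)) where
    field
      P : (Fin m → B.Carrier) → Set (b ⊔ ℓb)
      isSubgroup : GB.IsSubgroupPred P
      ⊆F : ∀ {y} → P y → IsFlow y

  -- Elements of the Boolean algebra of subsets of Ω generated by the
  -- products (s + H) × (t + K) of a coset of a subgroup H ≤ T with a coset
  -- of a subgroup K ≤ F.  (Codes, interpreted by ⟦_⟧ below.)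
  data Code : Set (lsuc (a ⊔ ℓa ⊔ b ⊔ ℓb)) where
    coset× : (H : SubgroupT) (s : Fin m → A.Carrier) → IsTension s →
             (K : SubgroupF) (t : Fin m → B.Carrier) → IsFlow t → Code
    _∪_ _∩_ : Code → Code → Code
    ∁c : Code → Code

  ⟦_⟧ : Code → Ω → Set (a ⊔ ℓa ⊔ b ⊔ ℓb)
  ⟦ coset× H s _ K t _ ⟧ ω =
    SubgroupT.P H (λ e → f ω e A.∙ s e A.⁻¹) × SubgroupF.P K (λ e → g ω e B.∙ t e B.⁻¹)
  ⟦ c ∪ d ⟧ ω = ⟦ c ⟧ ω ⊎ ⟦ d ⟧ ω
  ⟦ c ∩ d ⟧ ω = ⟦ c ⟧ ω × ⟦ d ⟧ ω
  ⟦ ∁c c ⟧ ω = ¬ ⟦ c ⟧ ω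

  SameSet : Code → Code → Set (a ⊔ ℓa ⊔ b ⊔ ℓb)
  SameSet c d = ∀ ω → ¬ ¬ (⟦ c ⟧ ω ⇔ ⟦ d ⟧ ω)

  record Valuation {r ℓr} (R : CommutativeRing r ℓr) : Set (lsuc (a ⊔ ℓa ⊔ b ⊔ ℓb) ⊔ r ⊔ ℓr) where
    open CommutativeRing R
    field
      ν : Code → Carrier
      ν-wd : ∀ {c d} → SameSet c d → ν c ≈ ν d
      ν-∅ : ∀ {c} → (∀ ω → ¬ ⟦ c ⟧ ω) → ν c ≈ 0#
      ν-modular : ∀ c d → ν (c ∪ d) + ν (c ∩ d) ≈ ν c + ν d

  vanishT : Subset m → SubgroupT
  vanishT X = record
    { P = λ x → Lift (a ⊔ ℓa) (IsTension x × (∀ e → e ∈ X → x e A.≈ A.ε))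
    ; isSubgroup = GA.lift-subgroup (a ⊔ ℓa)
                     (GA.∩-subgroup tension-subgroup (GA.vanish-subgroup (_∈ X)))
    ; ⊆T = λ p → proj₁ (lower p)
    }

  vanishF : Subset m → SubgroupF
  vanishF Y = record
    { P = λ y → Lift (b ⊔ ℓb) (IsFlow y × (∀ e → e ∈ Y → y e B.≈ B.ε))
    ; isSubgroup = GB.lift-subgroup (b ⊔ ℓb)
                     (GB.∩-subgroup flow-subgroup (GB.vanish-subgroup (_∈ Y)))
    ; ⊆F = λ p → proj₁ (lower p)
    }

  -- Ω_{X,Y} = {(f,g) ∈ Ω : f|_X = 0, g|_Y = 0}, the product of the
  -- subgroups vanishT X and vanishF Y (cosets of the zero tension/flow)
  zeroT : IsTension (λ _ → A.ε)
  zeroT = GA.IsSubgroupPred.has-ε tension-subgroup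

  zeroF : IsFlow (λ _ → B.ε)
  zeroF = GB.IsSubgroupPred.has-ε flow-subgroup

  Ωc : Subset m → Subset m → Code
  Ωc X Y = coset× (vanishT X) (λ _ → A.ε) zeroT (vanishF Y) (λ _ → B.ε) zeroF

  Ωall : Code
  Ωall = Ωc ⊥ ⊥

  ⋂ : ∀ {k} → (Fin k → Code) → Code
  ⋂ {zero} cs = Ωall
  ⋂ {suc k} cs = cs zero ∩ ⋂ (λ e → cs (suc e))

  -- Ω⁰_{X,Y} = {(f,g) ∈ Ω : ker f = X, ker g = Y}
  --          = Ω_{X,Y} ∩ ⋂_{e ∉ X} (Ω − Ω_{{e},∅}) ∩ ⋂_{e ∉ Y} (Ω − Ω_{∅,{e}})
  Ω⁰c : Subset m → Subset m → Code
  Ω⁰c X Y = Ωc X Y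
    ∩ (⋂ (λ e → if lookup X e then Ωall else ∁c (Ωc ⁅ e ⁆ ⊥))
    ∩ ⋂ (λ e → if lookup Y e then Ωall else ∁c (Ωc ⊥ ⁅ e ⁆)))

  -- the predicate Ω⁰_{X,Y} (for reference; ⟦ Ω⁰c X Y ⟧ is this set)
  Ω⁰ : Subset m → Subset m → Ω → Set (ℓa ⊔ ℓb)
  Ω⁰ X Y ω = (∀ e → e ∈ X ⇔ f ω e A.≈ A.ε) × (∀ e → e ∈ Y ⇔ g ω e B.≈ B.ε)

allSubsets : ∀ k → List (Subset k)
allSubsets zero = [] ∷ []
allSubsets (suc k) = map (outside ∷_) (allSubsets k) ++ map (inside ∷_) (allSubsets k)

module Integrals {a ℓa b ℓb r ℓr} (G : OrientedGraph) (A : AbelianGroup a ℓa) (B : AbelianGroup b ℓb)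
                 (R : CommutativeRing r ℓr) where
  open OrientedGraph G
  open Setting G A B
  open CommutativeRing R
  open Exp semiring public using (_^_)

  sumR : List Carrier → Carrier
  sumR = foldr _+_ 0#

  -- ∬_P w dν = Σ_{(X,Y) satisfying P} w_{X,Y} ν(Ω⁰_{X,Y})
  -- (P a decidable condition on (ker f, ker g) = (X,Y))
  ∬ : (V : Valuation R) → (P : Subset m → Subset m → Set) → (∀ X Y → Dec (P X Y)) →
      (Subset m → Subset m → Carrier) → Carrier
  ∬ V P P? w = sumR (concatMap (λ X → map (λ Y → w X Y * Valuation.ν V (Ω⁰c X Y))
                                            (filter (P? X) (allSubsets m)))
                               (allSubsets m))

module Submission where

-- Every (f,g) lies in exactly one cell Ω⁰_{ker f, ker g}, so these cells partition Ω, and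
-- Ω_{Z,E−Z} is the union of the cells with E − Y ⊆ Z ⊆ X.  Additivity of ν therefore gives
--   Σ_Z u^|Z| ν(Ω_{Z,E−Z}) = Σ_{X,Y} ν(Ω⁰_{X,Y}) Σ_{E−Y ⊆ Z ⊆ X} u^|Z|,
-- and the inner sum is u^|E−Y| (u+1)^|X−(E−Y)| when E − Y ⊆ X (that is, supp g ⊆ ker f)
-- and 0 otherwise, which is the integrand of the left-hand side.

open import Defs
open import Algebra.Bundles using (AbelianGroup; CommutativeRing)
open import Data.List.Base using (map)
open import Data.Fin.Subset using (Subset; ∁; _⊆_; _─_; ∣_∣)
open import Data.Fin.Subset.Properties using (_⊆?_)

open import Data.Bool.Base using (true; false; if_then_else_)
open import Level using (Lift; lift)
open import Data.Nat.Base using (zero; suc)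
open import Data.Fin.Base using (Fin; zero; suc)
open import Data.Fin.Subset using (inside; outside; _∈_; ⊥; ⁅_⁆)
open import Data.Fin.Subset.Properties
  using (⊆-antisym; drop-there; x∈∁p⇒x∉p; x∉∁p⇒x∈p; ∉⊥; x∈⁅x⁆; x∈⁅y⁆⇒x≡y)
open import Data.Vec.Base using ([]; _∷_; here; there; lookup)
open import Data.Vec.Properties using (∷-injectiveʳ; []=⇒lookup; lookup⇒[]=)
open import Data.List.Base using (List; []; _∷_; _++_; foldr; concatMap; filter; cartesianProduct)
open import Data.List.Properties using (map-++)
open import Data.List.Relation.Unary.All using (All; []; _∷_)
import Data.List.Relation.Unary.All as All
open import Data.List.Relation.Unary.Any as Any using (Any)
open import Data.List.Relation.Unary.Unique.Propositional using (Unique)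
open import Data.List.Relation.Unary.AllPairs using ([]; _∷_)
import Data.List.Relation.Unary.Unique.Propositional.Properties as Unique
open import Data.List.Membership.Propositional using (lose) renaming (_∈_ to _∈ₗ_)
open import Data.List.Membership.Propositional.Properties
  using (∈-map⁺; ∈-map⁻; ∈-++⁺ˡ; ∈-++⁺ʳ; ∈-cartesianProduct⁺)
open import Data.Product.Base using (∃; _×_; _,_; proj₁; proj₂; uncurry)
open import Data.Sum.Base using (inj₁; inj₂)
open import Data.Product.Function.NonDependent.Propositional using (_×-⇔_)
open import Function.Base using (_∘_; case_of_)
open import Function.Bundles using (_⇔_; mk⇔; Equivalence)
open import Relation.Nullary using (¬_; Dec; yes; no; does; contradiction)
open import Relation.Nullary.Decidable using (¬¬-excluded-middle)
open import Relation.Binary.PropositionalEquality as ≡ using (_≡_; _≢_)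

module FiniteSums {r ℓr} (R : CommutativeRing r ℓr) where
  open CommutativeRing R
  open import Relation.Binary.Reasoning.Setoid setoid

  sum : List Carrier → Carrier
  sum = foldr _+_ 0#

  ∑ : ∀ {t} {T : Set t} → List T → (T → Carrier) → Carrier
  ∑ L F = sum (map F L)

  𝟙 : ∀ {p} {P : Set p} → Dec P → Carrier
  𝟙 P? = if does P? then 1# else 0#

  sum-++ : ∀ xs ys → sum (xs ++ ys) ≈ sum xs + sum ys
  sum-++ []       ys = sym (+-identityˡ _)
  sum-++ (x ∷ xs) ys = trans (+-congˡ (sum-++ xs ys)) (sym (+-assoc _ _ _))

  sum-concatMap : ∀ {t} {T : Set t} (g : T → List Carrier) (L : List T) →
    sum (concatMap g L) ≈ ∑ L (sum ∘ g)
  sum-concatMap g []      = refl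
  sum-concatMap g (x ∷ L) = trans (sum-++ (g x) (concatMap g L)) (+-congˡ (sum-concatMap g L))

  module _ {t} {T : Set t} where

    ∑-cong : ∀ (L : List T) {F G : T → Carrier} → (∀ x → F x ≈ G x) → ∑ L F ≈ ∑ L G
    ∑-cong []      F≈G = refl
    ∑-cong (x ∷ L) F≈G = +-cong (F≈G x) (∑-cong L F≈G)

    ∑-cong-All : ∀ {L : List T} {F G : T → Carrier} → All (λ x → F x ≈ G x) L → ∑ L F ≈ ∑ L G
    ∑-cong-All []           = refl
    ∑-cong-All (Fx≈Gx ∷ F≈G) = +-cong Fx≈Gx (∑-cong-All F≈G)

    ∑-zero : ∀ (L : List T) {F : T → Carrier} → (∀ x → F x ≈ 0#) → ∑ L F ≈ 0#
    ∑-zero []      F≈0 = refl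
    ∑-zero (x ∷ L) F≈0 = trans (+-cong (F≈0 x) (∑-zero L F≈0)) (+-identityˡ 0#)

    ∑-+ : ∀ (L : List T) (F G : T → Carrier) → ∑ L (λ x → F x + G x) ≈ ∑ L F + ∑ L G
    ∑-+ []      F G = sym (+-identityˡ 0#)
    ∑-+ (x ∷ L) F G = begin
      (F x + G x) + ∑ L (λ x → F x + G x) ≈⟨ +-congˡ (∑-+ L F G) ⟩
      (F x + G x) + (∑ L F + ∑ L G)       ≈⟨ +-assoc (F x) (G x) _ ⟩
      F x + (G x + (∑ L F + ∑ L G))       ≈⟨ +-congˡ (x+yz≈y+xz (G x) (∑ L F) (∑ L G)) ⟩
      F x + (∑ L F + (G x + ∑ L G))       ≈⟨ +-assoc (F x) (∑ L F) _ ⟨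
      (F x + ∑ L F) + (G x + ∑ L G)       ∎
      where open import Algebra.Properties.CommutativeSemigroup +-commutativeSemigroup
              using () renaming (x∙yz≈y∙xz to x+yz≈y+xz)

    ∑-*ˡ : ∀ (L : List T) c (F : T → Carrier) → ∑ L (λ x → c * F x) ≈ c * ∑ L F
    ∑-*ˡ []      c F = sym (zeroʳ c)
    ∑-*ˡ (x ∷ L) c F = trans (+-congˡ (∑-*ˡ L c F)) (sym (distribˡ c _ _))

    ∑-*ʳ : ∀ (L : List T) c (F : T → Carrier) → ∑ L (λ x → F x * c) ≈ ∑ L F * c
    ∑-*ʳ []      c F = sym (zeroˡ c)
    ∑-*ʳ (x ∷ L) c F = trans (+-congˡ (∑-*ʳ L c F)) (sym (distribʳ c _ _))

    ∑-++ : ∀ (L M : List T) (F : T → Carrier) → ∑ (L ++ M) F ≈ ∑ L F + ∑ M F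
    ∑-++ L M F = trans (reflexive (≡.cong sum (map-++ F L M))) (sum-++ (map F L) (map F M))

    ∑-filter : ∀ {p} {P : T → Set p} (P? : ∀ x → Dec (P x)) (L : List T) (F : T → Carrier) →
      ∑ (filter P? L) F ≈ ∑ L (λ x → 𝟙 (P? x) * F x)
    ∑-filter P? []      F = refl
    ∑-filter P? (x ∷ L) F with does (P? x)
    ... | true  = +-cong (sym (*-identityˡ (F x))) (∑-filter P? L F)
    ... | false = trans (∑-filter P? L F) (sym (trans (+-congʳ (zeroˡ (F x))) (+-identityˡ _)))

  ∑-map : ∀ {s t} {S : Set s} {T : Set t} (h : S → T) (L : List S) (F : T → Carrier) →
    ∑ (map h L) F ≡ ∑ L (F ∘ h)
  ∑-map h []      F = ≡.refl
  ∑-map h (x ∷ L) F = ≡.cong (F (h x) +_) (∑-map h L F)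

  module _ {s t} {S : Set s} {T : Set t} where

    ∑-comm : ∀ (L : List S) (M : List T) (H : S → T → Carrier) →
      ∑ L (λ x → ∑ M (H x)) ≈ ∑ M (λ y → ∑ L (λ x → H x y))
    ∑-comm []      M H = sym (∑-zero M (λ _ → refl))
    ∑-comm (x ∷ L) M H =
      trans (+-congˡ (∑-comm L M H)) (sym (∑-+ M (H x) (λ y → ∑ L (λ x → H x y))))

    ∑-cartesianProduct : ∀ (L : List S) (M : List T) (F : S × T → Carrier) →
      ∑ (cartesianProduct L M) F ≈ ∑ L (λ x → ∑ M (λ y → F (x , y)))
    ∑-cartesianProduct []      M F = refl
    ∑-cartesianProduct (x ∷ L) M F = begin
      ∑ (map (x ,_) M ++ cartesianProduct L M) F         ≈⟨ ∑-++ (map (x ,_) M) _ F ⟩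
      ∑ (map (x ,_) M) F + ∑ (cartesianProduct L M) F    ≈⟨ +-cong (reflexive (∑-map (x ,_) M F))
                                                                   (∑-cartesianProduct L M F) ⟩
      ∑ M (λ y → F (x , y)) + ∑ L (λ x → ∑ M (λ y → F (x , y))) ∎

  ∑-*-∑-∑-comm : ∀ {s t v} {S : Set s} {T : Set t} {U : Set v}
    (L : List S) (M : List T) (N : List U) (c : S → Carrier) (H : S → T → U → Carrier) →
    ∑ L (λ z → c z * ∑ M (λ x → ∑ N (H z x))) ≈ ∑ M (λ x → ∑ N (λ y → ∑ L (λ z → c z * H z x y)))
  ∑-*-∑-∑-comm L M N c H = begin
    ∑ L (λ z → c z * ∑ M (λ x → ∑ N (H z x)))          ≈⟨ ∑-cong L (λ z → sym (c*∑∑ z)) ⟩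
    ∑ L (λ z → ∑ M (λ x → ∑ N (λ y → c z * H z x y)))  ≈⟨ ∑-comm L M _ ⟩
    ∑ M (λ x → ∑ L (λ z → ∑ N (λ y → c z * H z x y)))  ≈⟨ ∑-cong M (λ x → ∑-comm L N _) ⟩
    ∑ M (λ x → ∑ N (λ y → ∑ L (λ z → c z * H z x y)))  ∎
    where
    c*∑∑ : ∀ z → ∑ M (λ x → ∑ N (λ y → c z * H z x y)) ≈ c z * ∑ M (λ x → ∑ N (H z x))
    c*∑∑ z = trans (∑-cong M (λ x → ∑-*ˡ N (c z) (H z x))) (∑-*ˡ M (c z) _)

  ∑ₛ : ∀ {k} → (Subset k → Carrier) → Carrier
  ∑ₛ {k} = ∑ (allSubsets k)

  ∑ₛ-suc : ∀ {k} (F : Subset (suc k) → Carrier) →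
    ∑ₛ F ≈ ∑ₛ (F ∘ (outside ∷_)) + ∑ₛ (F ∘ (inside ∷_))
  ∑ₛ-suc {k} F = trans (∑-++ (map (outside ∷_) (allSubsets k)) _ F)
    (+-cong (reflexive (∑-map (outside ∷_) (allSubsets k) F))
            (reflexive (∑-map (inside ∷_) (allSubsets k) F)))

module IntervalSums {r ℓr} (R : CommutativeRing r ℓr) (u : CommutativeRing.Carrier R) where
  open CommutativeRing R hiding (zero)
  open FiniteSums R
  open import Algebra.Properties.Semiring.Exp semiring using (_^_)
  open import Algebra.Properties.CommutativeSemigroup *-commutativeSemigroup using (x∙yz≈y∙xz)
  open import Relation.Binary.Reasoning.Setoid setoid

  private
    term : ∀ {k} → Subset k → Subset k → Subset k → Carrier
    term A X Z = u ^ ∣ Z ∣ * (𝟙 (A ⊆? Z) * 𝟙 (Z ⊆? X))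

    ∑ₛ-u^suc : ∀ {k} (A X : Subset k) →
      ∑ₛ (λ Z → u ^ suc ∣ Z ∣ * (𝟙 (A ⊆? Z) * 𝟙 (Z ⊆? X))) ≈ u * ∑ₛ (term A X)
    ∑ₛ-u^suc {k} A X =
      trans (∑-cong (allSubsets k) (λ _ → *-assoc _ _ _)) (∑-*ˡ (allSubsets k) u (term A X))

    x*[y*0]≈0 : ∀ {x y} → x * (y * 0#) ≈ 0#
    x*[y*0]≈0 = trans (*-congˡ (zeroʳ _)) (zeroʳ _)

    x*[0*y]≈0 : ∀ {x y} → x * (0# * y) ≈ 0#
    x*[0*y]≈0 = trans (*-congˡ (zeroˡ _)) (zeroʳ _)

  interval-power-sum : ∀ {k} (A X : Subset k) →
    ∑ₛ (λ Z → u ^ ∣ Z ∣ * (𝟙 (A ⊆? Z) * 𝟙 (Z ⊆? X)))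
      ≈ 𝟙 (A ⊆? X) * (u ^ ∣ A ∣ * (u + 1#) ^ ∣ X ─ A ∣)
  interval-power-sum [] [] = +-identityʳ _
  interval-power-sum {suc k} (outside ∷ A) (outside ∷ X) = begin
    ∑ₛ (term (outside ∷ A) (outside ∷ X)) ≈⟨ ∑ₛ-suc (term (outside ∷ A) (outside ∷ X)) ⟩
    ∑ₛ (term A X) + ∑ₛ (λ Z → u ^ suc ∣ Z ∣ * (𝟙 (A ⊆? Z) * 0#))
      ≈⟨ +-congˡ (∑-zero (allSubsets k) (λ _ → x*[y*0]≈0)) ⟩
    ∑ₛ (term A X) + 0#                                     ≈⟨ +-identityʳ _ ⟩
    ∑ₛ (term A X)                                          ≈⟨ interval-power-sum A X ⟩
    𝟙 (A ⊆? X) * (u ^ ∣ A ∣ * (u + 1#) ^ ∣ X ─ A ∣)       ∎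
  interval-power-sum {suc k} (outside ∷ A) (inside ∷ X) = begin
    ∑ₛ (term (outside ∷ A) (inside ∷ X)) ≈⟨ ∑ₛ-suc (term (outside ∷ A) (inside ∷ X)) ⟩
    ∑ₛ (term A X) + ∑ₛ (λ Z → u ^ suc ∣ Z ∣ * (𝟙 (A ⊆? Z) * 𝟙 (Z ⊆? X))) ≈⟨ +-congˡ (∑ₛ-u^suc A X) ⟩
    ∑ₛ (term A X) + u * ∑ₛ (term A X)                                    ≈⟨ x+ux≈[u+1]x _ ⟩
    (u + 1#) * ∑ₛ (term A X)                                            ≈⟨ *-congˡ (interval-power-sum A X) ⟩
    (u + 1#) * (𝟙 (A ⊆? X) * (u ^ ∣ A ∣ * (u + 1#) ^ ∣ X ─ A ∣))       ≈⟨ x∙yz≈y∙xz _ _ _ ⟩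
    𝟙 (A ⊆? X) * ((u + 1#) * (u ^ ∣ A ∣ * (u + 1#) ^ ∣ X ─ A ∣))       ≈⟨ *-congˡ (x∙yz≈y∙xz _ _ _) ⟩
    𝟙 (A ⊆? X) * (u ^ ∣ A ∣ * (u + 1#) ^ suc ∣ X ─ A ∣)                ∎
    where
    x+ux≈[u+1]x : ∀ x → x + u * x ≈ (u + 1#) * x
    x+ux≈[u+1]x x = trans (+-comm x (u * x))
      (trans (+-congˡ (sym (*-identityˡ x))) (sym (distribʳ x u 1#)))
  interval-power-sum {suc k} (inside ∷ A) (outside ∷ X) = begin
    ∑ₛ (term (inside ∷ A) (outside ∷ X)) ≈⟨ ∑ₛ-suc (term (inside ∷ A) (outside ∷ X)) ⟩
    ∑ₛ (λ Z → u ^ ∣ Z ∣ * (0# * 𝟙 (Z ⊆? X))) + ∑ₛ (λ Z → u ^ suc ∣ Z ∣ * (𝟙 (A ⊆? Z) * 0#))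
      ≈⟨ +-cong (∑-zero (allSubsets k) (λ _ → x*[0*y]≈0)) (∑-zero (allSubsets k) (λ _ → x*[y*0]≈0)) ⟩
    0# + 0#  ≈⟨ +-identityʳ 0# ⟩
    0#       ≈⟨ zeroˡ _ ⟨
    0# * _   ∎
  interval-power-sum {suc k} (inside ∷ A) (inside ∷ X) = begin
    ∑ₛ (term (inside ∷ A) (inside ∷ X)) ≈⟨ ∑ₛ-suc (term (inside ∷ A) (inside ∷ X)) ⟩
    ∑ₛ (λ Z → u ^ ∣ Z ∣ * (0# * 𝟙 (Z ⊆? X))) + ∑ₛ (λ Z → u ^ suc ∣ Z ∣ * (𝟙 (A ⊆? Z) * 𝟙 (Z ⊆? X)))
      ≈⟨ +-cong (∑-zero (allSubsets k) (λ _ → x*[0*y]≈0)) (∑ₛ-u^suc A X) ⟩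
    0# + u * ∑ₛ (term A X)                                   ≈⟨ +-identityˡ _ ⟩
    u * ∑ₛ (term A X)                                        ≈⟨ *-congˡ (interval-power-sum A X) ⟩
    u * (𝟙 (A ⊆? X) * (u ^ ∣ A ∣ * (u + 1#) ^ ∣ X ─ A ∣))  ≈⟨ x∙yz≈y∙xz _ _ _ ⟩
    𝟙 (A ⊆? X) * (u * (u ^ ∣ A ∣ * (u + 1#) ^ ∣ X ─ A ∣))  ≈⟨ *-congˡ (*-assoc _ _ _) ⟨
    𝟙 (A ⊆? X) * (u ^ suc ∣ A ∣ * (u + 1#) ^ ∣ X ─ A ∣)    ∎

  interval-power-sum-* : ∀ {k} (A X : Subset k) t →
    ∑ₛ (λ Z → u ^ ∣ Z ∣ * ((𝟙 (A ⊆? Z) * 𝟙 (Z ⊆? X)) * t))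
      ≈ 𝟙 (A ⊆? X) * ((u ^ ∣ A ∣ * (u + 1#) ^ ∣ X ─ A ∣) * t)
  interval-power-sum-* {k} A X t = begin
    ∑ₛ (λ Z → u ^ ∣ Z ∣ * ((𝟙 (A ⊆? Z) * 𝟙 (Z ⊆? X)) * t))
      ≈⟨ ∑-cong (allSubsets k) (λ Z → *-assoc _ _ t) ⟨
    ∑ₛ (λ Z → term A X Z * t)                                    ≈⟨ ∑-*ʳ (allSubsets k) t (term A X) ⟩
    ∑ₛ (term A X) * t                                            ≈⟨ *-congʳ (interval-power-sum A X) ⟩
    (𝟙 (A ⊆? X) * (u ^ ∣ A ∣ * (u + 1#) ^ ∣ X ─ A ∣)) * t       ≈⟨ *-assoc _ _ t ⟩
    𝟙 (A ⊆? X) * ((u ^ ∣ A ∣ * (u + 1#) ^ ∣ X ─ A ∣) * t)       ∎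

allSubsets-complete : ∀ {k} (X : Subset k) → X ∈ₗ allSubsets k
allSubsets-complete []                = Any.here ≡.refl
allSubsets-complete {suc k} (outside ∷ X) = ∈-++⁺ˡ (∈-map⁺ (outside ∷_) (allSubsets-complete X))
allSubsets-complete {suc k} (inside ∷ X)  =
  ∈-++⁺ʳ (map (outside ∷_) (allSubsets k)) (∈-map⁺ (inside ∷_) (allSubsets-complete X))

allSubsets-unique : ∀ k → Unique (allSubsets k)
allSubsets-unique zero    = [] ∷ []
allSubsets-unique (suc k) =
  Unique.++⁺ (Unique.map⁺ ∷-injectiveʳ (allSubsets-unique k))
             (Unique.map⁺ ∷-injectiveʳ (allSubsets-unique k))
             disjoint
  where
  disjoint : ∀ {Z} → ¬ (Z ∈ₗ map (outside ∷_) (allSubsets k) × Z ∈ₗ map (inside ∷_) (allSubsets k))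
  disjoint (Z∈outside , Z∈inside) with ∈-map⁻ (outside ∷_) Z∈outside | ∈-map⁻ (inside ∷_) Z∈inside
  ... | _ , _ , ≡.refl | _ , _ , ()

same-members⇒≡ : ∀ {k p} {P : Fin k → Set p} {X Y : Subset k} →
  (∀ e → e ∈ X ⇔ P e) → (∀ e → e ∈ Y ⇔ P e) → X ≡ Y
same-members⇒≡ X⇔P Y⇔P =
  ⊆-antisym (λ {e} e∈X → from (Y⇔P e) (to (X⇔P e) e∈X))
            (λ {e} e∈Y → from (X⇔P e) (to (Y⇔P e) e∈Y))
  where open Equivalence

¬¬-subset : ∀ {k p} (P : Fin k → Set p) → ¬ ¬ (∃ λ (X : Subset k) → ∀ e → e ∈ X ⇔ P e)
¬¬-subset {zero}  P ¬∃ = ¬∃ ([] , λ ())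
¬¬-subset {suc k} {p} P ¬∃ =
  ¬¬-excluded-middle λ P₀? → ¬¬-subset (P ∘ suc) λ (X , X⇔P) →
    ¬∃ (does P₀? ∷ X , λ { zero    → zero∈⇔ P₀?
                         ; (suc e) → mk⇔ (to (X⇔P e) ∘ drop-there) (there ∘ from (X⇔P e)) })
  where
  zero∈⇔ : ∀ {Q : Set p} (Q? : Dec Q) {X : Subset k} → zero ∈ (does Q? ∷ X) ⇔ Q
  zero∈⇔ (yes q) = mk⇔ (λ _ → q) (λ _ → here)
  zero∈⇔ (no ¬q) = mk⇔ (λ ()) (λ q → contradiction q ¬q)
  open Equivalence

∁p⊆q⇒∁q⊆p : ∀ {k} {p q : Subset k} → ∁ p ⊆ q → ∁ q ⊆ p
∁p⊆q⇒∁q⊆p ∁p⊆q x∈∁q = x∉∁p⇒x∈p (λ x∈∁p → x∈∁p⇒x∉p x∈∁q (∁p⊆q x∈∁p))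

module _ {c ℓ} (C : AbelianGroup c ℓ) where
  open AbelianGroup C
  open import Algebra.Properties.AbelianGroup C using (ε⁻¹≈ε)

  ∙ε⁻¹≈ : ∀ x → x ∙ ε ⁻¹ ≈ x
  ∙ε⁻¹≈ x = trans (∙-congˡ ε⁻¹≈ε) (identityʳ x)

  vanishing-subgroup-coset⇔ : ∀ {k p q} {P : (Fin k → Carrier) → Set p} →
    (∀ {x y} → (∀ e → x e ≈ y e) → P x → P y) → ∀ {x} → P x → (X : Subset k) →
    Lift q (P (λ e → x e ∙ ε ⁻¹) × (∀ e → e ∈ X → x e ∙ ε ⁻¹ ≈ ε)) ⇔ (∀ e → e ∈ X → x e ≈ ε)
  vanishing-subgroup-coset⇔ P-resp {x} Px X = mk⇔
    (λ (lift (_ , vanishes)) e e∈X → trans (sym (∙ε⁻¹≈ (x e))) (vanishes e e∈X))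
    (λ vanishes → lift ( P-resp (λ e → sym (∙ε⁻¹≈ (x e))) Px
                       , λ e e∈X → trans (∙ε⁻¹≈ (x e)) (vanishes e e∈X)))

module Cells {a ℓa b ℓb} (G : OrientedGraph) (A : AbelianGroup a ℓa) (B : AbelianGroup b ℓb) where
  open OrientedGraph G
  open Setting G A B
  open Equivalence
  private
    module A = AbelianGroup A
    module B = AbelianGroup B
    module GA = GroupFacts A
    module GB = GroupFacts B

  ker-f : Ω → Fin m → Set ℓa
  ker-f ω e = f ω e A.≈ A.ε

  ker-g : Ω → Fin m → Set ℓb
  ker-g ω e = g ω e B.≈ B.ε

  ∈Ωc⇔ : ∀ X Y ω → ⟦ Ωc X Y ⟧ ω ⇔ ((∀ e → e ∈ X → ker-f ω e) × (∀ e → e ∈ Y → ker-g ω e))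
  ∈Ωc⇔ X Y ω =
    vanishing-subgroup-coset⇔ A (GA.IsSubgroupPred.resp tension-subgroup) (f-tension ω) X
    ×-⇔ vanishing-subgroup-coset⇔ B (GB.IsSubgroupPred.resp flow-subgroup) (g-flow ω) Y

  ∈Ωall : ∀ ω → ⟦ Ωall ⟧ ω
  ∈Ωall ω = from (∈Ωc⇔ ⊥ ⊥ ω) ((λ _ e∈⊥ → contradiction e∈⊥ ∉⊥) , (λ _ e∈⊥ → contradiction e∈⊥ ∉⊥))

  ∈⋂⇔ : ∀ {k} (cs : Fin k → Code) ω → ⟦ ⋂ cs ⟧ ω ⇔ (∀ e → ⟦ cs e ⟧ ω)
  ∈⋂⇔ {zero}  cs ω = mk⇔ (λ _ ()) (λ _ → ∈Ωall ω)
  ∈⋂⇔ {suc k} cs ω = mk⇔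
    (λ (c₀ , cs₊) → λ { zero → c₀ ; (suc e) → to (∈⋂⇔ (cs ∘ suc) ω) cs₊ e })
    (λ all → all zero , from (∈⋂⇔ (cs ∘ suc) ω) (all ∘ suc))

  ∈Ωc⁅e⁆⊥⇔ : ∀ e ω → ⟦ Ωc ⁅ e ⁆ ⊥ ⟧ ω ⇔ ker-f ω e
  ∈Ωc⁅e⁆⊥⇔ e ω = mk⇔
    (λ w → proj₁ (to (∈Ωc⇔ ⁅ e ⁆ ⊥ ω) w) e (x∈⁅x⁆ e))
    (λ ker → from (∈Ωc⇔ ⁅ e ⁆ ⊥ ω)
      ( (λ e′ e′∈⁅e⁆ → ≡.subst (ker-f ω) (≡.sym (x∈⁅y⁆⇒x≡y e e′∈⁅e⁆)) ker)
      , (λ _ e∈⊥ → contradiction e∈⊥ ∉⊥)))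

  ∈Ωc⊥⁅e⁆⇔ : ∀ e ω → ⟦ Ωc ⊥ ⁅ e ⁆ ⟧ ω ⇔ ker-g ω e
  ∈Ωc⊥⁅e⁆⇔ e ω = mk⇔
    (λ w → proj₂ (to (∈Ωc⇔ ⊥ ⁅ e ⁆ ω) w) e (x∈⁅x⁆ e))
    (λ ker → from (∈Ωc⇔ ⊥ ⁅ e ⁆ ω)
      ( (λ _ e∈⊥ → contradiction e∈⊥ ∉⊥)
      , (λ e′ e′∈⁅e⁆ → ≡.subst (ker-g ω) (≡.sym (x∈⁅y⁆⇒x≡y e e′∈⁅e⁆)) ker)))

  module _ {q} (σ : Fin m → Code) (K : Ω → Fin m → Set q) (σ⇔K : ∀ e ω → ⟦ σ e ⟧ ω ⇔ K ω e) where

    ∈kernel-bound⇔ : ∀ X ω →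
      ⟦ ⋂ (λ e → if lookup X e then Ωall else ∁c (σ e)) ⟧ ω ⇔ (∀ e → K ω e → e ∈ X)
    ∈kernel-bound⇔ X ω = mk⇔
      (λ w e k → lookup⇒[]= e X (bounded (lookup X e) (to (∈⋂⇔ _ ω) w e) k))
      (λ bound → from (∈⋂⇔ _ ω) (λ e → bounding (lookup X e) ([]=⇒lookup ∘ bound e)))
      where
      bounded : ∀ {e} x → ⟦ if x then Ωall else ∁c (σ e) ⟧ ω → K ω e → x ≡ true
      bounded true  _  _ = ≡.refl
      bounded false ¬σ k = contradiction (from (σ⇔K _ ω) k) ¬σ
      bounding : ∀ {e} x → (K ω e → x ≡ true) → ⟦ if x then Ωall else ∁c (σ e) ⟧ ω
      bounding true  _     = ∈Ωall ω
      bounding false bound σ with () ← bound (to (σ⇔K _ ω) σ)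

  ∈Ω⁰c⇔ : ∀ X Y ω → ⟦ Ω⁰c X Y ⟧ ω ⇔ Ω⁰ X Y ω
  ∈Ω⁰c⇔ X Y ω = mk⇔
    (λ (w , f-bound , g-bound) →
      let (X⊆ker-f , Y⊆ker-g) = to (∈Ωc⇔ X Y ω) w in
      (λ e → mk⇔ (X⊆ker-f e) (to (f-bound⇔ X ω) f-bound e)) ,
      (λ e → mk⇔ (Y⊆ker-g e) (to (g-bound⇔ Y ω) g-bound e)))
    (λ (X⇔ker-f , Y⇔ker-g) →
      from (∈Ωc⇔ X Y ω) ((λ e → to (X⇔ker-f e)) , (λ e → to (Y⇔ker-g e))) ,
      from (f-bound⇔ X ω) (λ e → from (X⇔ker-f e)) ,
      from (g-bound⇔ Y ω) (λ e → from (Y⇔ker-g e)))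
    where
    f-bound⇔ : ∀ X ω → ⟦ ⋂ (λ e → if lookup X e then Ωall else ∁c (Ωc ⁅ e ⁆ ⊥)) ⟧ ω
                       ⇔ (∀ e → ker-f ω e → e ∈ X)
    f-bound⇔ = ∈kernel-bound⇔ (λ e → Ωc ⁅ e ⁆ ⊥) ker-f ∈Ωc⁅e⁆⊥⇔
    g-bound⇔ : ∀ Y ω → ⟦ ⋂ (λ e → if lookup Y e then Ωall else ∁c (Ωc ⊥ ⁅ e ⁆)) ⟧ ω
                       ⇔ (∀ e → ker-g ω e → e ∈ Y)
    g-bound⇔ = ∈kernel-bound⇔ (λ e → Ωc ⊥ ⁅ e ⁆) ker-g ∈Ωc⊥⁅e⁆⇔

  Ω⁰-unique : ∀ {X Y X′ Y′ ω} → Ω⁰ X Y ω → Ω⁰ X′ Y′ ω → (X , Y) ≡ (X′ , Y′)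
  Ω⁰-unique (X⇔ker-f , Y⇔ker-g) (X′⇔ker-f , Y′⇔ker-g) =
    ≡.cong₂ _,_ (same-members⇒≡ X⇔ker-f X′⇔ker-f) (same-members⇒≡ Y⇔ker-g Y′⇔ker-g)

  ¬¬-Ω⁰ : ∀ ω → ¬ ¬ (∃ λ ((X , Y) : Subset m × Subset m) → Ω⁰ X Y ω)
  ¬¬-Ω⁰ ω ¬∃ = ¬¬-subset (ker-f ω) λ (X , X⇔ker-f) → ¬¬-subset (ker-g ω) λ (Y , Y⇔ker-g) →
    ¬∃ ((X , Y) , X⇔ker-f , Y⇔ker-g)

  ∈Ωc∩Ω⁰c⇔ : ∀ Z X Y ω → ⟦ Ωc Z (∁ Z) ∩ Ω⁰c X Y ⟧ ω ⇔ ((∁ Y ⊆ Z × Z ⊆ X) × ⟦ Ω⁰c X Y ⟧ ω)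
  ∈Ωc∩Ω⁰c⇔ Z X Y ω = mk⇔
    (λ (w , w⁰) →
      let (Z⊆ker-f , ∁Z⊆ker-g) = to (∈Ωc⇔ Z (∁ Z) ω) w
          (X⇔ker-f , Y⇔ker-g)  = to (∈Ω⁰c⇔ X Y ω) w⁰
      in ( ∁p⊆q⇒∁q⊆p (λ {e} e∈∁Z → from (Y⇔ker-g e) (∁Z⊆ker-g e e∈∁Z))
         , (λ {e} e∈Z → from (X⇔ker-f e) (Z⊆ker-f e e∈Z)) ) , w⁰)
    (λ ((∁Y⊆Z , Z⊆X) , w⁰) →
      let (X⇔ker-f , Y⇔ker-g) = to (∈Ω⁰c⇔ X Y ω) w⁰
      in from (∈Ωc⇔ Z (∁ Z) ω)
           ( (λ e e∈Z → to (X⇔ker-f e) (Z⊆X e∈Z))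
           , (λ e e∈∁Z → to (Y⇔ker-g e) (∁p⊆q⇒∁q⊆p ∁Y⊆Z e∈∁Z)) ) , w⁰)

module Valuations {a ℓa b ℓb r ℓr}
                  (G : OrientedGraph) (A : AbelianGroup a ℓa) (B : AbelianGroup b ℓb)
                  (R : CommutativeRing r ℓr) (V : Setting.Valuation G A B R) where
  open OrientedGraph G
  open Setting G A B
  open Cells G A B
  open Integrals G A B R using (∬)
  open CommutativeRing R hiding (zero)
  open FiniteSums R
  open Valuation V
  open Equivalence
  open import Relation.Binary.Reasoning.Setoid setoid

  ν-cong : ∀ {c d} → (∀ ω → ⟦ c ⟧ ω ⇔ ⟦ d ⟧ ω) → ν c ≈ ν d
  ν-cong c⇔d = ν-wd (λ ω ¬c⇔d → ¬c⇔d (c⇔d ω))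

  ν-split : ∀ c d → ν c ≈ ν (c ∩ d) + ν (c ∩ ∁c d)
  ν-split c d = begin
    ν c                                                    ≈⟨ +-identityʳ (ν c) ⟨
    ν c + 0#                                               ≈⟨ +-cong (ν-wd split) (ν-∅ disjoint) ⟨
    ν ((c ∩ d) ∪ (c ∩ ∁c d)) + ν ((c ∩ d) ∩ (c ∩ ∁c d))   ≈⟨ ν-modular (c ∩ d) (c ∩ ∁c d) ⟩
    ν (c ∩ d) + ν (c ∩ ∁c d)                               ∎
    where
    disjoint : ∀ ω → ¬ ⟦ (c ∩ d) ∩ (c ∩ ∁c d) ⟧ ω
    disjoint ω ((_ , w) , (_ , ¬w)) = ¬w w
    split : SameSet ((c ∩ d) ∪ (c ∩ ∁c d)) c
    split ω ¬⇔ = ¬¬-excluded-middle λ d? → ¬⇔ (mk⇔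
      (λ { (inj₁ (w , _)) → w ; (inj₂ (w , _)) → w })
      (λ w → case d? of λ { (yes w′) → inj₁ (w , w′) ; (no ¬w′) → inj₂ (w , ¬w′) }))

  -- Whether f vanishes at an edge is undecidable for a setoid-valued A, so covers are only
  -- required up to double negation; valuations cannot tell the difference (see SameSet).
  ν-partition : ∀ {i} {I : Set i} (d : I → Code) → (∀ {j k} ω → ⟦ d j ⟧ ω → ⟦ d k ⟧ ω → j ≡ k) →
    ∀ c (L : List I) → Unique L → (∀ ω → ⟦ c ⟧ ω → ¬ ¬ Any (λ j → ⟦ d j ⟧ ω) L) →
    ν c ≈ ∑ L (λ j → ν (c ∩ d j))
  ν-partition d d-disjoint c []      _              covered = ν-∅ (λ ω w → covered ω w λ ())
  ν-partition d d-disjoint c (j ∷ L) (j∉L ∷ unique) covered = begin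
    ν c                                                   ≈⟨ ν-split c (d j) ⟩
    ν (c ∩ d j) + ν (c ∩ ∁c (d j))
      ≈⟨ +-congˡ (ν-partition d d-disjoint _ L unique covered′) ⟩
    ν (c ∩ d j) + ∑ L (λ k → ν ((c ∩ ∁c (d j)) ∩ d k))
      ≈⟨ +-congˡ (∑-cong-All (All.map drop-∁dj j∉L)) ⟩
    ν (c ∩ d j) + ∑ L (λ k → ν (c ∩ d k))                 ∎
    where
    covered′ : ∀ ω → ⟦ c ∩ ∁c (d j) ⟧ ω → ¬ ¬ Any (λ k → ⟦ d k ⟧ ω) L
    covered′ ω (w , ¬dj) ¬any = covered ω w λ { (Any.here dj) → ¬dj dj ; (Any.there any) → ¬any any }
    drop-∁dj : ∀ {k} → j ≢ k → ν ((c ∩ ∁c (d j)) ∩ d k) ≈ ν (c ∩ d k)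
    drop-∁dj j≢k = ν-cong λ ω → mk⇔ (λ ((w , _) , dk) → w , dk)
                                    (λ (w , dk) → (w , λ dj → j≢k (d-disjoint ω dj dk)) , dk)

  ν-Ω⁰-partition : ∀ c → ν c ≈ ∑ₛ (λ X → ∑ₛ (λ Y → ν (c ∩ Ω⁰c X Y)))
  ν-Ω⁰-partition c = trans
    (ν-partition (uncurry Ω⁰c) disjoint c (cartesianProduct (allSubsets m) (allSubsets m))
                 (Unique.cartesianProduct⁺ (allSubsets-unique m) (allSubsets-unique m)) covered)
    (∑-cartesianProduct (allSubsets m) (allSubsets m) _)
    where
    disjoint : ∀ {XY XY′} ω → ⟦ uncurry Ω⁰c XY ⟧ ω → ⟦ uncurry Ω⁰c XY′ ⟧ ω → XY ≡ XY′
    disjoint {X , Y} {X′ , Y′} ω w w′ = Ω⁰-unique {ω = ω} (to (∈Ω⁰c⇔ X Y ω) w) (to (∈Ω⁰c⇔ X′ Y′ ω) w′)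
    covered : ∀ ω → ⟦ c ⟧ ω →
      ¬ ¬ Any (λ XY → ⟦ uncurry Ω⁰c XY ⟧ ω) (cartesianProduct (allSubsets m) (allSubsets m))
    covered ω _ ¬any = ¬¬-Ω⁰ ω λ ((X , Y) , w⁰) →
      ¬any (lose (∈-cartesianProduct⁺ (allSubsets-complete X) (allSubsets-complete Y))
                 (from (∈Ω⁰c⇔ X Y ω) w⁰))

  ν-Ωc∩Ω⁰c : ∀ Z X Y → ν (Ωc Z (∁ Z) ∩ Ω⁰c X Y) ≈ (𝟙 (∁ Y ⊆? Z) * 𝟙 (Z ⊆? X)) * ν (Ω⁰c X Y)
  ν-Ωc∩Ω⁰c Z X Y with ∁ Y ⊆? Z | Z ⊆? X
  ... | yes ∁Y⊆Z | yes Z⊆X = begin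
    ν (Ωc Z (∁ Z) ∩ Ω⁰c X Y)   ≈⟨ ν-cong (λ ω → mk⇔ (proj₂ ∘ to (∈Ωc∩Ω⁰c⇔ Z X Y ω))
                                                    (λ w⁰ → from (∈Ωc∩Ω⁰c⇔ Z X Y ω) ((∁Y⊆Z , Z⊆X) , w⁰))) ⟩
    ν (Ω⁰c X Y)                ≈⟨ *-identityˡ _ ⟨
    1# * ν (Ω⁰c X Y)           ≈⟨ *-congʳ (*-identityˡ 1#) ⟨
    (1# * 1#) * ν (Ω⁰c X Y)    ∎
  ... | no ∁Y⊈Z | _ = trans (ν-∅ λ ω w → ∁Y⊈Z (proj₁ (proj₁ (to (∈Ωc∩Ω⁰c⇔ Z X Y ω) w))))
                            (sym (trans (*-congʳ (zeroˡ _)) (zeroˡ _)))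
  ... | yes _ | no Z⊈X = trans (ν-∅ λ ω w → Z⊈X (proj₂ (proj₁ (to (∈Ωc∩Ω⁰c⇔ Z X Y ω) w))))
                               (sym (trans (*-congʳ (zeroʳ _)) (zeroˡ _)))

  ν-Ωc-∁-as-∑ : ∀ Z →
    ν (Ωc Z (∁ Z)) ≈ ∑ₛ (λ X → ∑ₛ (λ Y → (𝟙 (∁ Y ⊆? Z) * 𝟙 (Z ⊆? X)) * ν (Ω⁰c X Y)))
  ν-Ωc-∁-as-∑ Z = trans (ν-Ω⁰-partition (Ωc Z (∁ Z)))
    (∑-cong (allSubsets m) λ X → ∑-cong (allSubsets m) λ Y → ν-Ωc∩Ω⁰c Z X Y)

  ∬-as-∑ : ∀ (P : Subset m → Subset m → Set) (P? : ∀ X Y → Dec (P X Y)) w →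
    ∬ V P P? w ≈ ∑ₛ (λ X → ∑ₛ (λ Y → 𝟙 (P? X Y) * (w X Y * ν (Ω⁰c X Y))))
  ∬-as-∑ P P? w = trans (sum-concatMap _ (allSubsets m))
    (∑-cong (allSubsets m) λ X → ∑-filter (P? X) (allSubsets m) λ Y → w X Y * ν (Ω⁰c X Y))

corollary6p6 : ∀ {a ℓa b ℓb r ℓr}
    (G : OrientedGraph) (A : AbelianGroup a ℓa) (B : AbelianGroup b ℓb)
    (R : CommutativeRing r ℓr) →
    let open OrientedGraph G
        open Setting G A B
        open Integrals G A B R
        open CommutativeRing R
    in (u : Carrier) (V : Valuation R) →
       ∬ V (λ X Y → ∁ Y ⊆ X) (λ X Y → ∁ Y ⊆? X)
           (λ X Y → (u ^ ∣ ∁ Y ∣) * ((u + 1#) ^ ∣ X ─ ∁ Y ∣))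
       ≈ sumR (map (λ X → (u ^ ∣ X ∣) * Valuation.ν V (Ωc X (∁ X))) (allSubsets m))
corollary6p6 G A B R u V = begin
  ∬ V (λ X Y → ∁ Y ⊆ X) (λ X Y → ∁ Y ⊆? X) w
    ≈⟨ ∬-as-∑ _ _ w ⟩
  ∑ₛ (λ X → ∑ₛ λ Y → 𝟙 (∁ Y ⊆? X) * (w X Y * ν⁰ X Y))
    ≈⟨ ∑-cong (allSubsets m) (λ X → ∑-cong (allSubsets m) λ Y →
         interval-power-sum-* (∁ Y) X (ν⁰ X Y)) ⟨
  ∑ₛ (λ X → ∑ₛ λ Y → ∑ₛ λ Z → u ^ ∣ Z ∣ * ((𝟙 (∁ Y ⊆? Z) * 𝟙 (Z ⊆? X)) * ν⁰ X Y))
    ≈⟨ ∑-*-∑-∑-comm (allSubsets m) (allSubsets m) (allSubsets m) (λ Z → u ^ ∣ Z ∣) _ ⟨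
  ∑ₛ (λ Z → u ^ ∣ Z ∣ * ∑ₛ λ X → ∑ₛ λ Y → (𝟙 (∁ Y ⊆? Z) * 𝟙 (Z ⊆? X)) * ν⁰ X Y)
    ≈⟨ ∑-cong (allSubsets m) (λ Z → *-congˡ (ν-Ωc-∁-as-∑ Z)) ⟨
  ∑ₛ (λ Z → u ^ ∣ Z ∣ * ν (Ωc Z (∁ Z)))   ∎
  where
  open OrientedGraph G
  open Setting G A B
  open Integrals G A B R
  open CommutativeRing R hiding (zero)
  open Valuation V
  open FiniteSums R
  open IntervalSums R u
  open Valuations G A B R V
  open import Relation.Binary.Reasoning.Setoid setoid

  w : Subset m → Subset m → Carrier
  w X Y = u ^ ∣ ∁ Y ∣ * (u + 1#) ^ ∣ X ─ ∁ Y ∣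

  ν⁰ : Subset m → Subset m → Carrier
  ν⁰ X Y = ν (Ω⁰c X Y)
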